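{- Let $G=(V,E)$ be a finite connected graph with nonnegative resistance curvature, i.e. $\kappa_v\ge 0$ for all $v\in V$. Then for any probability measure $\mu$ on $V$, $$\min_{a\in V}\sum_{v\in V}\Omega_{av}\,\mu(v)\leq \Big(\sum_{v\in V}\kappa_v\Big)^{ -1}\leq \max_{b\in V}\sum_{v\in V}\Omega_{bv}\,\mu(v).$$ Moreover, $\big(\sum_{v\in V}\kappa_v\big)^{ -1}$ is the unique real number $\alpha$ such that $\min_{a\in V}\sum_{v}\Omega_{av}\mu(v)\le\alpha\le\max_{b\in V}\sum_v\Omega_{bv}\mu(v)$ holds for every probability measure $\mu$ on $V$.
   Context: Throughout, $G=(V,E)$ is a finite, simple, connected graph with vertices $v_1,\dots,v_n$, $n\ge 2$. Let $D$ be the diagonal degree matrix, $A$ the adjacency matrix, and $\Gamma = D-A+\frac1n J$, where $J$ is the $n\times n$ all-ones matrix. The resistance matrix $\Omega$ is defined by $\Omega_{ij}=(\Gamma^{ -1})_{ii}+(\Gamma^{ -1})_{jj}-2(\Gamma^{ -1})_{ij}$ (indexed by vertices); it is invertible. The resistance curvature is the unique vector $\kappa\in\mathbb{R}^n$ with $\Omega\kappa=\mathbf{1}$, $\mathbf 1=(1,\dots,1)$; $\kappa_v$ is the curvature at vertex $v$.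
   Formalization: The probability measures μ take rational values, and the number α in the uniqueness clause ranges over ℚ instead of the real numbers. -}

module Defs where

open import Data.Bool using (Bool; true; false; if_then_else_)
open import Data.Nat as ℕ using (ℕ; zero; suc)
open import Data.Fin using (Fin; zero; suc; _≟_)
open import Data.Integer using (+_)
open import Data.Rational using (ℚ; 0ℚ; 1ℚ; _+_; _-_; _*_; _≤_; _⊓_; _⊔_; 1/_; ≢-nonZero)
import Data.Rational as ℚ
open import Data.Product using (_×_)
open import Relation.Binary.PropositionalEquality using (_≡_; _≢_)
open import Relation.Nullary using (yes; no; ¬_)
open import Function using (_∘_)

record Graph (n : ℕ) : Set where
  field
    adj     : Fin n → Fin n → Bool
    symm    : ∀ i j → adj i j ≡ adj j i
    irrefl  : ∀ i → adj i i ≡ false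
open Graph public

data Reachable {n : ℕ} (G : Graph n) : Fin n → Fin n → Set where
  here : ∀ {i} → Reachable G i i
  step : ∀ {i j k} → adj G i j ≡ true → Reachable G j k → Reachable G i k

Connected : ∀ {n} → Graph n → Set
Connected G = ∀ i j → Reachable G i j

Σℚ : ∀ {n} → (Fin n → ℚ) → ℚ
Σℚ {zero}  f = 0ℚ
Σℚ {suc n} f = f zero + Σℚ (f ∘ suc)

minF : ∀ {n} → (Fin (suc n) → ℚ) → ℚ
minF {zero}  f = f zero
minF {suc n} f = f zero ⊓ minF (f ∘ suc)

maxF : ∀ {n} → (Fin (suc n) → ℚ) → ℚ
maxF {zero}  f = f zero
maxF {suc n} f = f zero ⊔ maxF (f ∘ suc)

Matrix : ℕ → Set
Matrix n = Fin n → Fin n → ℚ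

b2q : Bool → ℚ
b2q true  = 1ℚ
b2q false = 0ℚ

δ : ∀ {n} → Fin n → Fin n → ℚ
δ i j with i ≟ j
... | yes _ = 1ℚ
... | no  _ = 0ℚ

deg : ∀ {n} → Graph n → Fin n → ℚ
deg G i = Σℚ (λ j → b2q (adj G i j))

Dmat : ∀ {n} → Graph n → Matrix n
Dmat G i j = δ i j * deg G i

Amat : ∀ {n} → Graph n → Matrix n
Amat G i j = b2q (adj G i j)

Γ : ∀ {n} → .{{_ : ℕ.NonZero n}} → Graph n → Matrix n
Γ {n} G i j = (Dmat G i j - Amat G i j) + (+ 1 ℚ./ n)

_·_ : ∀ {n} → Matrix n → Matrix n → Matrix n
(M · N) i j = Σℚ (λ k → M i k * N k j)

-- X is the inverse of M (for square matrices over a field, MX = I forces X = M⁻¹).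
IsInverseOf : ∀ {n} → Matrix n → Matrix n → Set
IsInverseOf X M = (∀ i j → (M · X) i j ≡ δ i j) × (∀ i j → (X · M) i j ≡ δ i j)

Ω : ∀ {n} → Matrix n → Matrix n
Ω Γinv i j = (Γinv i i + Γinv j j) - ((+ 2 ℚ./ 1) * Γinv i j)

IsCurvature : ∀ {n} → Matrix n → (Fin n → ℚ) → Set
IsCurvature Om κ = ∀ i → Σℚ (λ j → Om i j * κ j) ≡ 1ℚ

IsProbability : ∀ {n} → (Fin n → ℚ) → Set
IsProbability μ = (∀ v → 0ℚ ≤ μ v) × Σℚ μ ≡ 1ℚ

-- Total reciprocal (inv 0 = 0, as a convention; only used on nonzero arguments).
inv : ℚ → ℚ
inv p with p ℚ.≟ 0ℚ
... | yes _ = 0ℚ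
... | no p≢0 = 1/_ p {{≢-nonZero p≢0}}

{-# OPTIONS --safe #-}
-- Γ is symmetric, hence so is its inverse and with it Ω. For a probability measure μ,
-- symmetry and Ωκ = 1 give Σₐ κₐ (Ωμ)ₐ = Σᵥ (Ωκ)ᵥ μᵥ = 1, and since κ ≥ 0 the left side
-- lies between Σκ · minₐ (Ωμ)ₐ and Σκ · maxₐ (Ωμ)ₐ; dividing by Σκ > 0 gives the bounds.
-- For uniqueness, μ = κ / Σκ makes Ωμ constant, equal to 1 / Σκ, so both bounds meet.
module Submission where

open import Defs
open import Data.Nat using (ℕ; suc)
import Data.Nat as ℕ
open import Data.Fin using (Fin; zero; suc; _≟_)
import Data.Integer as ℤ
open import Data.Rational
  using (ℚ; 0ℚ; 1ℚ; _+_; _-_; _*_; _/_; _≤_; _⊓_; _⊔_; 1/_; NonZero; Positive; ≢-nonZero; nonNegative)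
import Data.Rational.Properties as ℚ
open import Data.Rational.Properties
  using (+-*-ring; ≤-refl; ≤-trans; ≤-antisym; *-comm; *-assoc; *-identityˡ; *-zeroˡ)
open import Algebra.Bundles using (Ring)
open import Algebra.Properties.Semiring.Sum (Ring.semiring +-*-ring)
  using (sum; ∑-comm; *-distribˡ-sum; *-distribʳ-sum; sum-cong-≗; sum-replicate-zero)
open import Data.Product using (_×_; _,_; proj₁; proj₂)
open import Data.Empty using (⊥-elim)
open import Function using (_∘_)
open import Relation.Binary.PropositionalEquality
  using (_≡_; _≢_; refl; sym; trans; cong; cong₂; subst; subst₂; module ≡-Reasoning)
open import Relation.Nullary using (yes; no)

open ≡-Reasoning

Σℚ≡sum : ∀ {n} (f : Fin n → ℚ) → Σℚ f ≡ sum f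
Σℚ≡sum {ℕ.zero} f = refl
Σℚ≡sum {suc n}  f = cong (f zero +_) (Σℚ≡sum (f ∘ suc))

Σℚ-cong : ∀ {n} {f g : Fin n → ℚ} → (∀ i → f i ≡ g i) → Σℚ f ≡ Σℚ g
Σℚ-cong {f = f} {g} f≗g = trans (Σℚ≡sum f) (trans (sum-cong-≗ f≗g) (sym (Σℚ≡sum g)))

Σℚ-zero : ∀ n → Σℚ {n} (λ _ → 0ℚ) ≡ 0ℚ
Σℚ-zero n = trans (Σℚ≡sum {n} (λ _ → 0ℚ)) (sum-replicate-zero n)

*-distribˡ-Σℚ : ∀ {n} c (f : Fin n → ℚ) → c * Σℚ f ≡ Σℚ (λ i → c * f i)
*-distribˡ-Σℚ c f = begin
  c * Σℚ f               ≡⟨ cong (c *_) (Σℚ≡sum f) ⟩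
  c * sum f              ≡⟨ *-distribˡ-sum c f ⟩
  sum (λ i → c * f i)    ≡⟨ sym (Σℚ≡sum (λ i → c * f i)) ⟩
  Σℚ (λ i → c * f i)     ∎

*-distribʳ-Σℚ : ∀ {n} c (f : Fin n → ℚ) → Σℚ f * c ≡ Σℚ (λ i → f i * c)
*-distribʳ-Σℚ c f = begin
  Σℚ f * c               ≡⟨ cong (_* c) (Σℚ≡sum f) ⟩
  sum f * c              ≡⟨ *-distribʳ-sum c f ⟩
  sum (λ i → f i * c)    ≡⟨ sym (Σℚ≡sum (λ i → f i * c)) ⟩
  Σℚ (λ i → f i * c)     ∎

Σℚ-comm : ∀ {m n} (f : Fin m → Fin n → ℚ) →
          Σℚ (λ i → Σℚ (λ j → f i j)) ≡ Σℚ (λ j → Σℚ (λ i → f i j))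
Σℚ-comm f = begin
  Σℚ (λ i → Σℚ (λ j → f i j))   ≡⟨ trans (Σℚ-cong (λ i → Σℚ≡sum (f i))) (Σℚ≡sum (λ i → sum (f i))) ⟩
  sum (λ i → sum (λ j → f i j))  ≡⟨ ∑-comm f ⟩
  sum (λ j → sum (λ i → f i j))  ≡⟨ sym (trans (Σℚ-cong (λ j → Σℚ≡sum (λ i → f i j))) (Σℚ≡sum (λ j → sum (λ i → f i j)))) ⟩
  Σℚ (λ j → Σℚ (λ i → f i j))   ∎

Σℚ-mono-≤ : ∀ {n} {f g : Fin n → ℚ} → (∀ i → f i ≤ g i) → Σℚ f ≤ Σℚ g
Σℚ-mono-≤ {ℕ.zero} f≤g = ≤-refl
Σℚ-mono-≤ {suc n}  f≤g = ℚ.+-mono-≤ (f≤g zero) (Σℚ-mono-≤ (f≤g ∘ suc))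

Σℚ-nonNeg : ∀ {n} (f : Fin n → ℚ) → (∀ i → 0ℚ ≤ f i) → 0ℚ ≤ Σℚ f
Σℚ-nonNeg {n} f f≥0 = subst (_≤ Σℚ f) (Σℚ-zero n) (Σℚ-mono-≤ f≥0)

δ-suc : ∀ {n} (i j : Fin n) → δ (suc i) (suc j) ≡ δ i j
δ-suc i j with i ≟ j
... | yes _ = refl
... | no  _ = refl

δ-sym : ∀ {n} (i j : Fin n) → δ i j ≡ δ j i
δ-sym i j with i ≟ j | j ≟ i
... | yes _   | yes _   = refl
... | yes i≡j | no  j≢i = ⊥-elim (j≢i (sym i≡j))
... | no  i≢j | yes j≡i = ⊥-elim (i≢j (sym j≡i))
... | no  _   | no  _   = refl

δ*-on-diagonal : ∀ {n} (i j : Fin n) (f : Fin n → ℚ) → δ i j * f i ≡ δ i j * f j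
δ*-on-diagonal i j f with i ≟ j
... | yes refl = refl
... | no  _    = trans (*-zeroˡ (f i)) (sym (*-zeroˡ (f j)))

Σℚ-δ* : ∀ {n} (i : Fin n) (g : Fin n → ℚ) → Σℚ (λ l → δ i l * g l) ≡ g i
Σℚ-δ* {suc n} zero g = begin
  1ℚ * g zero + Σℚ (λ l → 0ℚ * g (suc l))  ≡⟨ cong₂ _+_ (*-identityˡ (g zero)) (trans (Σℚ-cong (λ l → *-zeroˡ (g (suc l)))) (Σℚ-zero n)) ⟩
  g zero + 0ℚ                              ≡⟨ ℚ.+-identityʳ _ ⟩
  g zero                                   ∎
Σℚ-δ* {suc n} (suc i) g = begin
  0ℚ * g zero + Σℚ (λ l → δ (suc i) (suc l) * g (suc l))  ≡⟨ cong₂ _+_ (*-zeroˡ (g zero)) (Σℚ-cong (λ l → cong (_* g (suc l)) (δ-suc i l))) ⟩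
  0ℚ + Σℚ (λ l → δ i l * g (suc l))                       ≡⟨ ℚ.+-identityˡ _ ⟩
  Σℚ (λ l → δ i l * g (suc l))                            ≡⟨ Σℚ-δ* i (g ∘ suc) ⟩
  g (suc i)                                               ∎

Σℚ-δ : ∀ {n} (i : Fin n) → Σℚ (δ i) ≡ 1ℚ
Σℚ-δ i = trans (Σℚ-cong (λ l → sym (ℚ.*-identityʳ (δ i l)))) (Σℚ-δ* i (λ _ → 1ℚ))

minF≤ : ∀ {n} (f : Fin (suc n) → ℚ) i → minF f ≤ f i
minF≤ {ℕ.zero} f zero    = ≤-refl
minF≤ {suc n}  f zero    = ℚ.p⊓q≤p (f zero) (minF (f ∘ suc))
minF≤ {suc n}  f (suc i) = ≤-trans (ℚ.p⊓q≤q (f zero) (minF (f ∘ suc))) (minF≤ (f ∘ suc) i)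

≤maxF : ∀ {n} (f : Fin (suc n) → ℚ) i → f i ≤ maxF f
≤maxF {ℕ.zero} f zero    = ≤-refl
≤maxF {suc n}  f zero    = ℚ.p≤p⊔q (f zero) (maxF (f ∘ suc))
≤maxF {suc n}  f (suc i) = ≤-trans (≤maxF (f ∘ suc) i) (ℚ.p≤q⊔p (f zero) (maxF (f ∘ suc)))

minF-const : ∀ {n} (f : Fin (suc n) → ℚ) c → (∀ i → f i ≡ c) → minF f ≡ c
minF-const {ℕ.zero} f c f≡c = f≡c zero
minF-const {suc n}  f c f≡c = trans (cong₂ _⊓_ (f≡c zero) (minF-const (f ∘ suc) c (f≡c ∘ suc))) (ℚ.⊓-idem c)

maxF-const : ∀ {n} (f : Fin (suc n) → ℚ) c → (∀ i → f i ≡ c) → maxF f ≡ c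
maxF-const {ℕ.zero} f c f≡c = f≡c zero
maxF-const {suc n}  f c f≡c = trans (cong₂ _⊔_ (f≡c zero) (maxF-const (f ∘ suc) c (f≡c ∘ suc))) (ℚ.⊔-idem c)

Σℚ*minF≤Σℚ-weighted : ∀ {n} (w f : Fin (suc n) → ℚ) → (∀ i → 0ℚ ≤ w i) →
                      Σℚ w * minF f ≤ Σℚ (λ i → w i * f i)
Σℚ*minF≤Σℚ-weighted w f w≥0 = subst (_≤ Σℚ (λ i → w i * f i)) (sym (*-distribʳ-Σℚ (minF f) w))
  (Σℚ-mono-≤ (λ i → ℚ.*-monoˡ-≤-nonNeg (w i) {{nonNegative (w≥0 i)}} (minF≤ f i)))

Σℚ-weighted≤Σℚ*maxF : ∀ {n} (w f : Fin (suc n) → ℚ) → (∀ i → 0ℚ ≤ w i) →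
                      Σℚ (λ i → w i * f i) ≤ Σℚ w * maxF f
Σℚ-weighted≤Σℚ*maxF w f w≥0 = subst (Σℚ (λ i → w i * f i) ≤_) (sym (*-distribʳ-Σℚ (maxF f) w))
  (Σℚ-mono-≤ (λ i → ℚ.*-monoˡ-≤-nonNeg (w i) {{nonNegative (w≥0 i)}} (≤maxF f i)))

inv-nonZero : ∀ p (p≢0 : p ≢ 0ℚ) → inv p ≡ (1/ p) {{≢-nonZero p≢0}}
inv-nonZero p p≢0 with p ℚ.≟ 0ℚ
... | yes p≡0 = ⊥-elim (p≢0 p≡0)
... | no  _   = refl

IsSymmetric : ∀ {n} → Matrix n → Set
IsSymmetric M = ∀ i j → M i j ≡ M j i

Dmat-symmetric : ∀ {n} (G : Graph n) → IsSymmetric (Dmat G)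
Dmat-symmetric G i j = trans (δ*-on-diagonal i j (deg G)) (cong (_* deg G j) (δ-sym i j))

Γ-symmetric : ∀ {n} .{{_ : ℕ.NonZero n}} (G : Graph n) → IsSymmetric (Γ G)
Γ-symmetric G i j = cong (_+ _) (cong₂ _-_ (Dmat-symmetric G i j) (cong b2q (symm G i j)))

leftInverse-symmetric : ∀ {n} {M X : Matrix n} → IsSymmetric M →
                        (∀ i j → (X · M) i j ≡ δ i j) → IsSymmetric X
leftInverse-symmetric {M = M} {X} M-sym XM≡I i j = begin
  X i j                                          ≡⟨ sym (Σℚ-δ* j (X i)) ⟩
  Σℚ (λ k → δ j k * X i k)                       ≡⟨ Σℚ-cong (λ k → cong (_* X i k) (sym (XM≡I j k))) ⟩
  Σℚ (λ k → Σℚ (λ l → X j l * M l k) * X i k)    ≡⟨ Σℚ-cong (λ k → *-distribʳ-Σℚ (X i k) (λ l → X j l * M l k)) ⟩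
  Σℚ (λ k → Σℚ (λ l → X j l * M l k * X i k))    ≡⟨ Σℚ-comm (λ k l → X j l * M l k * X i k) ⟩
  Σℚ (λ l → Σℚ (λ k → X j l * M l k * X i k))    ≡⟨ Σℚ-cong (λ l → Σℚ-cong (λ k → regroup l k)) ⟩
  Σℚ (λ l → Σℚ (λ k → X j l * (X i k * M k l)))  ≡⟨ Σℚ-cong (λ l → sym (*-distribˡ-Σℚ (X j l) (λ k → X i k * M k l))) ⟩
  Σℚ (λ l → X j l * Σℚ (λ k → X i k * M k l))    ≡⟨ Σℚ-cong (λ l → trans (cong (X j l *_) (XM≡I i l)) (*-comm (X j l) (δ i l))) ⟩
  Σℚ (λ l → δ i l * X j l)                       ≡⟨ Σℚ-δ* i (X j) ⟩
  X j i                                          ∎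
  where
  regroup : ∀ l k → X j l * M l k * X i k ≡ X j l * (X i k * M k l)
  regroup l k = trans (*-assoc (X j l) (M l k) (X i k))
                      (cong (X j l *_) (trans (*-comm (M l k) (X i k)) (cong (X i k *_) (M-sym l k))))

Ω-symmetric : ∀ {n} {X : Matrix n} → IsSymmetric X → IsSymmetric (Ω X)
Ω-symmetric {X = X} X-sym i j = cong₂ _-_ (ℚ.+-comm (X i i) (X j j)) (cong ((ℤ.+ 2 / 1) *_) (X-sym i j))

_*ᵥ_ : ∀ {n} → Matrix n → (Fin n → ℚ) → Fin n → ℚ
(M *ᵥ x) i = Σℚ (λ j → M i j * x j)

module CurvatureBounds {k} (M : Matrix (suc k)) (M-sym : IsSymmetric M)
                       (κ : Fin (suc k) → ℚ) (Mκ≡1 : IsCurvature M κ) (κ≥0 : ∀ v → 0ℚ ≤ κ v) where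

  Σκ*M*ᵥ≡Σℚ : ∀ μ → Σℚ (λ a → κ a * (M *ᵥ μ) a) ≡ Σℚ μ
  Σκ*M*ᵥ≡Σℚ μ = begin
    Σℚ (λ a → κ a * Σℚ (λ v → M a v * μ v))    ≡⟨ Σℚ-cong (λ a → *-distribˡ-Σℚ (κ a) (λ v → M a v * μ v)) ⟩
    Σℚ (λ a → Σℚ (λ v → κ a * (M a v * μ v)))  ≡⟨ Σℚ-comm (λ a v → κ a * (M a v * μ v)) ⟩
    Σℚ (λ v → Σℚ (λ a → κ a * (M a v * μ v)))  ≡⟨ Σℚ-cong (λ v → Σℚ-cong (λ a → regroup a v)) ⟩
    Σℚ (λ v → Σℚ (λ a → M v a * κ a * μ v))    ≡⟨ Σℚ-cong (λ v → sym (*-distribʳ-Σℚ (μ v) (λ a → M v a * κ a))) ⟩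
    Σℚ (λ v → (M *ᵥ κ) v * μ v)                ≡⟨ Σℚ-cong (λ v → trans (cong (_* μ v) (Mκ≡1 v)) (*-identityˡ (μ v))) ⟩
    Σℚ μ                                       ∎
    where
    regroup : ∀ a v → κ a * (M a v * μ v) ≡ M v a * κ a * μ v
    regroup a v = trans (sym (*-assoc (κ a) (M a v) (μ v)))
                        (cong (_* μ v) (trans (*-comm (κ a) (M a v)) (cong (_* κ a) (M-sym a v))))

  Σκ*minF≤1 : ∀ μ → Σℚ μ ≡ 1ℚ → Σℚ κ * minF (M *ᵥ μ) ≤ 1ℚ
  Σκ*minF≤1 μ Σμ≡1 = subst (Σℚ κ * minF (M *ᵥ μ) ≤_) (trans (Σκ*M*ᵥ≡Σℚ μ) Σμ≡1)
                           (Σℚ*minF≤Σℚ-weighted κ (M *ᵥ μ) κ≥0)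

  1≤Σκ*maxF : ∀ μ → Σℚ μ ≡ 1ℚ → 1ℚ ≤ Σℚ κ * maxF (M *ᵥ μ)
  1≤Σκ*maxF μ Σμ≡1 = subst (_≤ Σℚ κ * maxF (M *ᵥ μ)) (trans (Σκ*M*ᵥ≡Σℚ μ) Σμ≡1)
                           (Σℚ-weighted≤Σℚ*maxF κ (M *ᵥ μ) κ≥0)

  Σκ≢0 : Σℚ κ ≢ 0ℚ
  Σκ≢0 Σκ≡0 = ℚ.1≢0 (≤-antisym 1≤0 (ℚ.nonNegative⁻¹ 1ℚ))
    where
    1≤0 : 1ℚ ≤ 0ℚ
    1≤0 = subst (1ℚ ≤_) (trans (cong (_* maxF (M *ᵥ δ zero)) Σκ≡0) (*-zeroˡ (maxF (M *ᵥ δ zero))))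
                (1≤Σκ*maxF (δ zero) (Σℚ-δ {suc k} zero))

  instance
    Σκ-nonZero : NonZero (Σℚ κ)
    Σκ-nonZero = ≢-nonZero Σκ≢0

    Σκ-positive : Positive (Σℚ κ)
    Σκ-positive = ℚ.nonNeg∧nonZero⇒pos (Σℚ κ) {{nonNegative (Σℚ-nonNeg κ κ≥0)}}

  inv-Σκ : inv (Σℚ κ) ≡ 1/ Σℚ κ
  inv-Σκ = inv-nonZero (Σℚ κ) Σκ≢0

  Σκ*inv-Σκ≡1 : Σℚ κ * inv (Σℚ κ) ≡ 1ℚ
  Σκ*inv-Σκ≡1 = trans (cong (Σℚ κ *_) inv-Σκ) (ℚ.*-inverseʳ (Σℚ κ))

  minF≤inv-Σκ≤maxF : ∀ μ → IsProbability μ → (minF (M *ᵥ μ) ≤ inv (Σℚ κ)) × (inv (Σℚ κ) ≤ maxF (M *ᵥ μ))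
  minF≤inv-Σκ≤maxF μ (_ , Σμ≡1) =
      ℚ.*-cancelˡ-≤-pos (Σℚ κ) (subst (Σℚ κ * minF (M *ᵥ μ) ≤_) (sym Σκ*inv-Σκ≡1) (Σκ*minF≤1 μ Σμ≡1))
    , ℚ.*-cancelˡ-≤-pos (Σℚ κ) (subst (_≤ Σℚ κ * maxF (M *ᵥ μ)) (sym Σκ*inv-Σκ≡1) (1≤Σκ*maxF μ Σμ≡1))

  normalised-κ : Fin (suc k) → ℚ
  normalised-κ v = κ v * inv (Σℚ κ)

  inv-Σκ-nonNeg : 0ℚ ≤ inv (Σℚ κ)
  inv-Σκ-nonNeg = ℚ.*-cancelˡ-≤-pos (Σℚ κ)
    (subst₂ _≤_ (sym (ℚ.*-zeroʳ (Σℚ κ))) (sym Σκ*inv-Σκ≡1) (ℚ.nonNegative⁻¹ 1ℚ))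

  normalised-κ-isProbability : IsProbability normalised-κ
  normalised-κ-isProbability =
      (λ v → ℚ.nonNegative⁻¹ (normalised-κ v)
               {{ℚ.nonNeg*nonNeg⇒nonNeg (κ v) {{nonNegative (κ≥0 v)}} (inv (Σℚ κ)) {{nonNegative inv-Σκ-nonNeg}}}})
    , trans (sym (*-distribʳ-Σℚ (inv (Σℚ κ)) κ)) Σκ*inv-Σκ≡1

  M*ᵥnormalised-κ : ∀ a → (M *ᵥ normalised-κ) a ≡ inv (Σℚ κ)
  M*ᵥnormalised-κ a = begin
    Σℚ (λ v → M a v * (κ v * inv (Σℚ κ)))  ≡⟨ Σℚ-cong (λ v → sym (*-assoc (M a v) (κ v) (inv (Σℚ κ)))) ⟩
    Σℚ (λ v → M a v * κ v * inv (Σℚ κ))    ≡⟨ sym (*-distribʳ-Σℚ (inv (Σℚ κ)) (λ v → M a v * κ v)) ⟩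
    (M *ᵥ κ) a * inv (Σℚ κ)                ≡⟨ cong (_* inv (Σℚ κ)) (Mκ≡1 a) ⟩
    1ℚ * inv (Σℚ κ)                        ≡⟨ *-identityˡ (inv (Σℚ κ)) ⟩
    inv (Σℚ κ)                             ∎

  inv-Σκ-unique : ∀ α → (∀ μ → IsProbability μ → (minF (M *ᵥ μ) ≤ α) × (α ≤ maxF (M *ᵥ μ))) → α ≡ inv (Σℚ κ)
  inv-Σκ-unique α α-between = ≤-antisym
    (subst (α ≤_) (maxF-const _ _ M*ᵥnormalised-κ) (proj₂ (α-between normalised-κ normalised-κ-isProbability)))
    (subst (_≤ α) (minF-const _ _ M*ᵥnormalised-κ) (proj₁ (α-between normalised-κ normalised-κ-isProbability)))

theorem5 : (m : ℕ) (G : Graph (suc (suc m))) → Connected G →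
    (Γinv : Matrix (suc (suc m))) → IsInverseOf Γinv (Γ G) →
    (κ : Fin (suc (suc m)) → ℚ) → IsCurvature (Ω Γinv) κ →
    (∀ v → 0ℚ ≤ κ v) →
    ((μ : Fin (suc (suc m)) → ℚ) → IsProbability μ →
        (minF (λ a → Σℚ (λ v → Ω Γinv a v Data.Rational.* μ v)) ≤ inv (Σℚ κ))
        × (inv (Σℚ κ) ≤ maxF (λ b → Σℚ (λ v → Ω Γinv b v Data.Rational.* μ v))))
    × ((α : ℚ) →
        ((μ : Fin (suc (suc m)) → ℚ) → IsProbability μ →
          (minF (λ a → Σℚ (λ v → Ω Γinv a v Data.Rational.* μ v)) ≤ α)
          × (α ≤ maxF (λ b → Σℚ (λ v → Ω Γinv b v Data.Rational.* μ v)))) →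
        α ≡ inv (Σℚ κ))
-- Connectivity is only needed for Γ to be invertible, which is assumed outright.
theorem5 m G _ Γinv (_ , Γinv·Γ≡I) κ Ωκ≡1 κ≥0 = minF≤inv-Σκ≤maxF , inv-Σκ-unique
  where
  Ω-sym : IsSymmetric (Ω Γinv)
  Ω-sym = Ω-symmetric {X = Γinv} (leftInverse-symmetric {X = Γinv} (Γ-symmetric G) Γinv·Γ≡I)

  open CurvatureBounds (Ω Γinv) Ω-sym κ Ωκ≡1 κ≥0
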